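{- Let $M=((\lambda z.\,xz)\,y)$ and $N=xy$, and let $t\in W(M,N)$. Then exactly one of the following holds: (a) $t$ is obtained from the direct $\beta$-contraction $t_\beta$ by inserting reflexive witnesses on the left and/or right; (b) $t$ is obtained from the direct $\eta$-contraction $t_\eta$ by inserting reflexive witnesses on the left and/or right. In particular the tag $\mathrm{tag}(t)\in\{\beta,\eta\}$ (equal to $\beta$ in case (a) and $\eta$ in case (b)) is well defined.
   Context: Terms are untyped $\lambda$-terms (named-variable notation used for readability; $x,y$ are fixed free variables). $t_\beta$ is the one-step contraction $((\lambda z.xz)y)\to_\beta xz[y/z]=xy$, and $t_\eta$ is the one-step contraction obtained by the $\eta$-step $\lambda z.xz\to_\eta x$ in the function part, giving $((\lambda z.xz)y)\to xy$. For $A,B\in\{M,N\}$, $W(A,B)$ is the inductive family generated by $t_\beta,t_\eta\in W(M,N)$, $\mathsf{refl}_M\in W(M,M)$, $\mathsf{refl}_N\in W(N,N)$, and composition $u\cdot v\in W(A,C)$ for $u\in W(A,B)$, $v\in W(B,C)$; there is no inverse constructor. Inserting reflexive witnesses on the left/right means composing with $\mathsf{refl}_M$ before and/or $\mathsf{refl}_N$ after. -}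

module Defs where

open import Data.Product using (_×_)
open import Data.Sum using (_⊎_)
open import Relation.Nullary using (¬_)

data Obj : Set where
  M N : Obj

data W : Obj → Obj → Set where
  tβ tη : W M N
  reflM : W M M
  reflN : W N N
  _·_   : ∀ {A B C} → W A B → W B C → W A C

infixr 5 _·_

data IsRefl : ∀ {A B} → W A B → Set where
  rM   : IsRefl reflM
  rN   : IsRefl reflN
  comp : ∀ {A B C} {u : W A B} {v : W B C} → IsRefl u → IsRefl v → IsRefl (u · v)

data InsertedFrom (b : W M N) : W M N → Set where
  base  : InsertedFrom b b
  left  : ∀ {r : W M M} {u : W M N} → IsRefl r → InsertedFrom b u → InsertedFrom b (r · u)
  right : ∀ {u : W M N} {r : W N N} → InsertedFrom b u → IsRefl r → InsertedFrom b (u · r)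

ExactlyOne : Set → Set → Set
ExactlyOne P Q = (P ⊎ Q) × ¬ (P × Q)

-- Since no witness leads from N back to M, every witness of W(M,N) factors as
-- (M-loop) · (one contraction) · (N-loop), and every loop W(A,A) is built from
-- reflexive witnesses only.  The tag of the unique contraction is preserved by
-- inserting reflexive witnesses, so no witness comes from both t_β and t_η.
module Submission where

open import Defs
open import Data.Empty using (⊥-elim)
open import Data.Product using (_,_)
open import Data.Sum using (_⊎_; inj₁; inj₂; map)
open import Relation.Binary.PropositionalEquality using (_≡_; _≢_; refl; trans; sym)
open import Relation.Nullary using (¬_)

¬W-N-M : ¬ W N M
¬W-N-M (_·_ {B = M} u v) = ¬W-N-M u
¬W-N-M (_·_ {B = N} u v) = ¬W-N-M v

isRefl-loop : ∀ {A} (r : W A A) → IsRefl r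
isRefl-loop reflM = rM
isRefl-loop reflN = rN
isRefl-loop {M} (_·_ {B = M} u v) = comp (isRefl-loop u) (isRefl-loop v)
isRefl-loop {M} (_·_ {B = N} u v) = ⊥-elim (¬W-N-M v)
isRefl-loop {N} (_·_ {B = M} u v) = ⊥-elim (¬W-N-M u)
isRefl-loop {N} (_·_ {B = N} u v) = comp (isRefl-loop u) (isRefl-loop v)

insertedFrom-tβ⊎tη : (t : W M N) → InsertedFrom tβ t ⊎ InsertedFrom tη t
insertedFrom-tβ⊎tη tβ = inj₁ base
insertedFrom-tβ⊎tη tη = inj₂ base
insertedFrom-tβ⊎tη (_·_ {B = M} u v) =
  map (left (isRefl-loop u)) (left (isRefl-loop u)) (insertedFrom-tβ⊎tη v)
insertedFrom-tβ⊎tη (_·_ {B = N} u v) =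
  map (λ p → right p (isRefl-loop v)) (λ p → right p (isRefl-loop v)) (insertedFrom-tβ⊎tη u)

data Contraction : Set where
  β η : Contraction

tag : W M N → Contraction
tag tβ = β
tag tη = η
tag (_·_ {B = M} u v) = tag v
tag (_·_ {B = N} u v) = tag u

tag-insertedFrom : ∀ {b t} → InsertedFrom b t → tag t ≡ tag b
tag-insertedFrom base        = refl
tag-insertedFrom (left _ p)  = tag-insertedFrom p
tag-insertedFrom (right p _) = tag-insertedFrom p

β≢η : β ≢ η
β≢η ()

mainTheorem15 : (t : W M N) → ExactlyOne (InsertedFrom tβ t) (InsertedFrom tη t)
mainTheorem15 t =
    insertedFrom-tβ⊎tη t
  , λ { (fromβ , fromη) → β≢η (trans (sym (tag-insertedFrom fromβ)) (tag-insertedFrom fromη)) }
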